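{- Let $q\geq 3$, $n\geq 1$ and $s\leq n$ be integers. If $b(H(n,q-1))\geq s$, then $b(H(n,q))\geq s+1$.
   Context: For positive integers $n,q$, the Hamming graph $H(n,q)$ has vertex set $\{1,\ldots,q\}^n$, two vertices adjacent iff they differ in exactly one coordinate; $d(u,v)$ is the graph (Hamming) distance. For a finite graph $G$ with vertex set $V$, a vertex $v$ and integer $k\geq 0$, $\Gamma_k(v)=\{u\in V: d(u,v)\leq k\}$. A sequence $(v_1,\ldots,v_b)$ of vertices is a burning sequence of length $b$ if $\Gamma_{b-1}(v_1)\cup\Gamma_{b-2}(v_2)\cup\cdots\cup\Gamma_0(v_b)=V$, and the burning number $b(G)$ is the minimum length of a burning sequence. -}

module Defs where

open import Data.Nat using (ℕ; zero; suc; _+_; _∸_; _≤_)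
open import Data.Fin using (Fin; toℕ)
open import Data.Fin.Properties using (_≟_)
open import Data.Vec using (Vec; []; _∷_; lookup)
open import Data.Product using (∃-syntax; _×_)
open import Relation.Nullary using (yes; no)

-- Vertices of the Hamming graph H(n,q): words of length n over an alphabet
-- of q symbols (Fin q stands for {1,…,q}).
Vertex : ℕ → ℕ → Set
Vertex n q = Vec (Fin q) n

-- Hamming distance: number of coordinates in which two words differ
-- (this is the graph distance in H(n,q)).
dist : ∀ {n q} → Vertex n q → Vertex n q → ℕ
dist [] [] = 0
dist (x ∷ xs) (y ∷ ys) with x ≟ y
... | yes _ = dist xs ys
... | no  _ = suc (dist xs ys)

-- A burning sequence of length b is (v_1,…,v_b), given as Vec (Vertex n q) b
-- indexed v_1 = lookup 0, …; vertex v_i (1-based) burns radius b - i,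
-- i.e. for 0-based index j it burns radius b - 1 - j.
IsBurningSeq : ∀ {n q b} → Vec (Vertex n q) b → Set
IsBurningSeq {n} {q} {b} vs =
  ∀ (u : Vertex n q) → ∃[ j ] (dist u (lookup vs j) ≤ b ∸ suc (toℕ j))

-- b(H(n,q)) ≥ s : every burning sequence of H(n,q) has length at least s.
-- (b(H(n,q)) is the minimum such length; burning sequences always exist.)
BurningNumber≥ : ℕ → ℕ → ℕ → Set
BurningNumber≥ n q s = ∀ (b : ℕ) (vs : Vec (Vertex n q) b) → IsBurningSeq vs → s ≤ b

{-# OPTIONS --safe #-}
module Submission where

-- Let (v₁,…,v_b) burn H(n,q). If b > n then b ≥ s + 1 because s ≤ n. Otherwise the
-- words that differ from v₁ in every coordinate are at distance n ≥ b from v₁, so they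
-- are burned by v₂,…,v_b alone. These words form a copy of H(n,q−1), obtained by
-- punching v₁ into every coordinate, and the coordinatewise retraction onto this copy
-- does not increase distances. So the retracts of v₂,…,v_b burn H(n,q−1), and b − 1 ≥ s.

open import Defs
open import Data.Nat using (ℕ; zero; suc; _≤_; _<_; _∸_; z≤n; s≤s)
open import Data.Nat.Properties using (m≤n⇒m≤1+n; ≤-trans; _≤?_; ≰⇒>; <⇒≱)
open import Data.Fin using (Fin; zero; suc; toℕ; punchIn; punchOut)
open import Data.Fin.Properties using (_≟_; punchInᵢ≢i; punchOut-cong; punchOut-punchIn)
open import Data.Vec using (Vec; []; _∷_; lookup; map; replicate; zipWith)
open import Data.Vec.Properties using (lookup-map)
open import Data.Product using (_,_)
open import Relation.Nullary using (yes; no)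
open import Relation.Nullary.Negation using (contradiction)
open import Relation.Binary.PropositionalEquality using (_≡_; refl; sym; trans; cong; cong₂; subst)

dist-zipWith-≤ : ∀ {C : Set} {n q r} (f : C → Fin q → Fin r) (c : Vec C n) (x y : Vertex n q) →
                 dist (zipWith f c x) (zipWith f c y) ≤ dist x y
dist-zipWith-≤ f []      []       []       = z≤n
dist-zipWith-≤ f (c ∷ cs) (x ∷ xs) (y ∷ ys) with x ≟ y | f c x ≟ f c y
... | yes refl | yes _  = dist-zipWith-≤ f cs xs ys
... | yes refl | no fx≢fx = contradiction refl fx≢fx
... | no _     | yes _  = m≤n⇒m≤1+n (dist-zipWith-≤ f cs xs ys)
... | no _     | no _   = s≤s (dist-zipWith-≤ f cs xs ys)

module _ {p : ℕ} where

  punchOutOrZero : Fin (suc (suc p)) → Fin (suc (suc p)) → Fin (suc p)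
  punchOutOrZero a x with a ≟ x
  ... | yes _   = zero
  ... | no a≢x = punchOut a≢x

  punchOutOrZero-punchIn : ∀ a y → punchOutOrZero a (punchIn a y) ≡ y
  punchOutOrZero-punchIn a y with a ≟ punchIn a y
  ... | yes a≡a′ = contradiction (sym a≡a′) (punchInᵢ≢i a y)
  ... | no _     = trans (punchOut-cong a refl) (punchOut-punchIn a)

  avoiding : ∀ {n} → Vertex n (suc (suc p)) → Vertex n (suc p) → Vertex n (suc (suc p))
  avoiding = zipWith punchIn

  retract : ∀ {n} → Vertex n (suc (suc p)) → Vertex n (suc (suc p)) → Vertex n (suc p)
  retract = zipWith punchOutOrZero

  retract-avoiding : ∀ {n} (a : Vertex n (suc (suc p))) u → retract a (avoiding a u) ≡ u
  retract-avoiding []       []       = refl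
  retract-avoiding (a ∷ as) (y ∷ ys) = cong₂ _∷_ (punchOutOrZero-punchIn a y) (retract-avoiding as ys)

  dist-avoiding : ∀ {n} (a : Vertex n (suc (suc p))) u → dist (avoiding a u) a ≡ n
  dist-avoiding []       []       = refl
  dist-avoiding (a ∷ as) (y ∷ ys) with punchIn a y ≟ a
  ... | yes a′≡a = contradiction a′≡a (punchInᵢ≢i a y)
  ... | no _     = cong suc (dist-avoiding as ys)

  dist-retract-≤ : ∀ {n} (a : Vertex n (suc (suc p))) u w → dist u (retract a w) ≤ dist (avoiding a u) w
  dist-retract-≤ a u w =
    subst (λ v → dist v (retract a w) ≤ dist (avoiding a u) w)
          (retract-avoiding a u)
          (dist-zipWith-≤ punchOutOrZero a (avoiding a u) w)

  retract-tail-isBurningSeq : ∀ {n b} (v : Vertex n (suc (suc p))) (vs : Vec (Vertex n (suc (suc p))) b) →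
                              b < n → IsBurningSeq (v ∷ vs) → IsBurningSeq (map (retract v) vs)
  retract-tail-isBurningSeq {b = b} v vs b<n burns u with burns (avoiding v u)
  ... | zero  , d≤b = contradiction (subst (_≤ b) (dist-avoiding v u) d≤b) (<⇒≱ b<n)
  ... | suc k , d≤r = k , subst (λ w → dist u w ≤ b ∸ suc (toℕ k)) (sym (lookup-map k (retract v) vs))
                            (≤-trans (dist-retract-≤ v u (lookup vs k)) d≤r)

  burningNumber≥-suc : ∀ n s → s ≤ n → BurningNumber≥ n (suc p) s → BurningNumber≥ n (suc (suc p)) (suc s)
  burningNumber≥-suc n s s≤n bound zero [] burns with burns (replicate n zero)
  ... | () , _
  burningNumber≥-suc n s s≤n bound (suc b) (v ∷ vs) burns with n ≤? b
  ... | yes n≤b = s≤s (≤-trans s≤n n≤b)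
  ... | no n≰b  = s≤s (bound b (map (retract v) vs) (retract-tail-isBurningSeq v vs (≰⇒> n≰b) burns))

claim3p1 : ∀ (q n s : ℕ) → 3 ≤ q → 1 ≤ n → s ≤ n →
           BurningNumber≥ n (q ∸ 1) s → BurningNumber≥ n q (suc s)
claim3p1 zero          n s ()
claim3p1 (suc zero)    n s (s≤s ())
claim3p1 (suc (suc p)) n s _ _ s≤n = burningNumber≥-suc n s s≤n
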